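{- Let $(h(n))_{n\in\mathbb{N}}$ be defined by $h(n)=1$ for all integers $n\le 1$ and $h(n)=h(n-h(n-1))+h(n-2)$ for $n>1$. Then $h(0)=h(1)=1$ and for all $n\in\mathbb{N}$ we have $$h(2n+1)=n+1,\qquad h(2n+2)=h(2n)+h(n+1).$$
   Context: $\mathbb{N}=\{0,1,2,\dots\}$. The sequence is the meta-Fibonacci sequence $h_{1,1}$; values at non-positive indices are fixed to $1$ so that all terms are defined. -}

module Defs where

open import Data.Nat using (ℕ; zero; suc; _+_; _∸_; _≤ᵇ_)
open import Data.Bool using (if_then_else_)

-- The meta-Fibonacci sequence h = h_{1,1}:
--   h(n) = 1 for all integers n ≤ 1,
--   h(n) = h(n - h(n-1)) + h(n-2) for n > 1.
-- Negative indices are handled by truncated subtraction: if n - h(n-1) < 0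
-- then n ∸ h(n-1) = 0 and h(0) = 1, which is the prescribed value 1.
--
-- hUpTo k i = h(i) for every i ≤ k (course-of-values computation).
-- One extension step: given g agreeing with h on indices ≤ k+1, produce a
-- function agreeing with h on indices ≤ k+2.
step : ℕ → (ℕ → ℕ) → ℕ → ℕ
step k g i =
  if i ≤ᵇ suc k then g i else g (suc (suc k) ∸ g (suc k)) + g k

hUpTo : ℕ → ℕ → ℕ
hUpTo zero = λ _ → 1
hUpTo (suc zero) = λ _ → 1
hUpTo (suc (suc k)) = step k (hUpTo (suc k))

h : ℕ → ℕ
h n = hUpTo n n

open import Relation.Binary.PropositionalEquality using (_≡_; refl)
open import Data.List using (List; map; upTo; _∷_; [])
private
  test : map h (upTo 13) ≡ 1 ∷ 1 ∷ 2 ∷ 2 ∷ 4 ∷ 3 ∷ 6 ∷ 4 ∷ 10 ∷ 5 ∷ 13 ∷ 6 ∷ 19 ∷ []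
  test = refl

{-# OPTIONS --safe #-}
-- Since h ≥ 1, the recurrence gives h(k+2) ≥ 2 for every k. Inductively
-- h(2n+1) = n + 1 and h(2n) ≥ 2n: the first makes the step back from 2n+2 land
-- on n+1, so h(2n+2) = h(n+1) + h(2n) ≥ 2 + 2n; this bound makes the step back
-- from 2n+3 land on an index ≤ 1, so h(2n+3) = 1 + h(2n+1) = n + 2.
module Submission where

open import Defs
open import Data.Nat using (ℕ; zero; suc; _+_; _*_; _∸_; _≤_; _<_; _≤ᵇ_; z≤n; s≤s)
open import Data.Nat.Properties
open import Data.Bool using (true; false)
open import Data.Empty using (⊥-elim)
open import Data.Product using (_×_; _,_)
open import Data.Sum using (inj₁; inj₂)
open import Data.Unit using (tt)
open import Relation.Binary.PropositionalEquality

step-below : ∀ {k i} (g : ℕ → ℕ) → i ≤ suc k → step k g i ≡ g i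
step-below {k} {i} g i≤1+k with i ≤ᵇ suc k | ≤⇒≤ᵇ i≤1+k
... | true | _ = refl

step-top : ∀ k (g : ℕ → ℕ) →
           step k g (suc (suc k)) ≡ g (suc (suc k) ∸ g (suc k)) + g k
step-top k g with suc (suc k) ≤ᵇ suc k | ≤ᵇ⇒≤ (suc (suc k)) (suc k)
... | false | _ = refl
... | true  | 2+k≤1+k = ⊥-elim (n≮n (suc k) (2+k≤1+k tt))

hUpTo-suc : ∀ {i} k → i ≤ k → hUpTo (suc k) i ≡ hUpTo k i
hUpTo-suc zero    _   = refl
hUpTo-suc (suc k) i≤k = step-below (hUpTo (suc k)) i≤k

hUpTo-stable : ∀ {i} k → i ≤ k → hUpTo k i ≡ h i
hUpTo-stable k i≤k with m≤n⇒m<n∨m≡n i≤k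
hUpTo-stable k       i≤k | inj₂ refl       = refl
hUpTo-stable (suc k) i≤k | inj₁ (s≤s i≤k′) =
  trans (hUpTo-suc k i≤k′) (hUpTo-stable k i≤k′)

step-positive : ∀ k {g : ℕ → ℕ} → (∀ i → 0 < g i) → ∀ i → 0 < step k g i
step-positive k {g} g>0 i with i ≤ᵇ suc k
... | true  = g>0 i
... | false = ≤-trans (g>0 _) (m≤m+n _ _)

hUpTo-positive : ∀ k i → 0 < hUpTo k i
hUpTo-positive zero          _ = s≤s z≤n
hUpTo-positive (suc zero)    _ = s≤s z≤n
hUpTo-positive (suc (suc k))   = step-positive k (hUpTo-positive (suc k))

h-positive : ∀ i → 0 < h i
h-positive i = hUpTo-positive i i

h-recurrence : ∀ k → h (suc (suc k)) ≡ h (suc (suc k) ∸ h (suc k)) + h k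
h-recurrence k = begin
  h (suc (suc k))                                         ≡⟨ step-top k (hUpTo (suc k)) ⟩
  hUpTo (suc k) (suc (suc k) ∸ hUpTo (suc k) (suc k))
    + hUpTo (suc k) k                                     ≡⟨ cong₂ _+_ (hUpTo-stable (suc k) back≤1+k)
                                                                       (hUpTo-stable (suc k) (n≤1+n k)) ⟩
  h (suc (suc k) ∸ h (suc k)) + h k                       ∎
  where
  open ≡-Reasoning
  back≤1+k : suc (suc k) ∸ h (suc k) ≤ suc k
  back≤1+k = ∸-monoʳ-≤ (suc (suc k)) (h-positive (suc k))

h-≤1 : ∀ {j} → j ≤ 1 → h j ≡ 1
h-≤1 z≤n       = refl
h-≤1 (s≤s z≤n) = refl

h-≥2 : ∀ k → 2 ≤ h (suc (suc k))
h-≥2 k = subst (2 ≤_) (sym (h-recurrence k))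
               (+-mono-≤ (h-positive (suc (suc k) ∸ h (suc k))) (h-positive k))

h-after-large : ∀ k → suc k ≤ h (suc k) → h (suc (suc k)) ≡ suc (h k)
h-after-large k 1+k≤h = begin
  h (suc (suc k))                         ≡⟨ h-recurrence k ⟩
  h (suc (suc k) ∸ h (suc k)) + h k       ≡⟨ cong (_+ h k) (h-≤1 back≤1) ⟩
  suc (h k)                               ∎
  where
  open ≡-Reasoning
  back≤1 : suc (suc k) ∸ h (suc k) ≤ 1
  back≤1 = ≤-trans (∸-monoʳ-≤ (suc (suc k)) 1+k≤h) (≤-reflexive (m+n∸n≡m 1 k))

h-even-recurrence : ∀ n → h (suc (2 * n)) ≡ suc n →
                    h (suc (suc (2 * n))) ≡ h (suc n) + h (2 * n)
h-even-recurrence n h[2n+1]≡1+n = begin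
  h (suc (suc (2 * n)))                                  ≡⟨ h-recurrence (2 * n) ⟩
  h (suc (suc (2 * n)) ∸ h (suc (2 * n))) + h (2 * n)    ≡⟨ cong (λ m → h (suc (suc (2 * n)) ∸ m) + h (2 * n))
                                                                 h[2n+1]≡1+n ⟩
  h (suc n + (n + 0) ∸ n) + h (2 * n)                    ≡⟨ cong (λ m → h (suc n + m ∸ n) + h (2 * n))
                                                                 (+-identityʳ n) ⟩
  h (suc n + n ∸ n) + h (2 * n)                          ≡⟨ cong (λ m → h m + h (2 * n)) (m+n∸n≡m (suc n) n) ⟩
  h (suc n) + h (2 * n)                                  ∎
  where open ≡-Reasoning

even-lower-bound : ∀ n → 2 * n ≤ h (2 * n) → suc (suc (2 * n)) ≤ h (suc n) + h (2 * n)
even-lower-bound zero    _  = ≤-refl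
even-lower-bound (suc m) lb = +-mono-≤ (h-≥2 m) lb

h-even-odd : ∀ n → 2 * n ≤ h (2 * n) × h (suc (2 * n)) ≡ suc n
h-even-odd zero = z≤n , refl
h-even-odd (suc n) with h-even-odd n
... | lb , odd = subst (λ m → m ≤ h m) (sym 2[1+n]≡2+2n) lb′
               , subst (λ m → h (suc m) ≡ suc (suc n)) (sym 2[1+n]≡2+2n)
                       (trans (h-after-large (suc (2 * n)) lb′) (cong suc odd))
  where
  2[1+n]≡2+2n : 2 * suc n ≡ suc (suc (2 * n))
  2[1+n]≡2+2n = *-suc 2 n
  lb′ : suc (suc (2 * n)) ≤ h (suc (suc (2 * n)))
  lb′ = subst (suc (suc (2 * n)) ≤_) (sym (h-even-recurrence n odd)) (even-lower-bound n lb)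

theorem3p1 : (h 0 ≡ 1 × h 1 ≡ 1)
    × ((n : ℕ) → h (2 * n + 1) ≡ n + 1 × h (2 * n + 2) ≡ h (2 * n) + h (n + 1))
theorem3p1 = (refl , refl) , λ n → odd n , even n
  where
  odd : ∀ n → h (2 * n + 1) ≡ n + 1
  odd n with h-even-odd n
  ... | _ , h[2n+1]≡1+n rewrite +-comm (2 * n) 1 | +-comm n 1 = h[2n+1]≡1+n

  even : ∀ n → h (2 * n + 2) ≡ h (2 * n) + h (n + 1)
  even n with h-even-odd n
  ... | _ , h[2n+1]≡1+n rewrite +-comm (2 * n) 2 | +-comm n 1 | +-comm (h (2 * n)) (h (suc n)) =
    h-even-recurrence n h[2n+1]≡1+n
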